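{- Let $(a,b,c,r,s;x_1,y_1,\dots,x_N,y_N)$ be a set of solutions in basic form with $x_1=y_1=y_2=0$, $x_i>0$ for all $i>1$, $y_i>0$ for all $i>2$, such that no two of $x_2,\dots,x_N$ are equal and no two of $y_3,\dots,y_N$ are equal. Then $x_2=\min(x_2,x_3,\dots,x_N)$, except when the set is a subset of $(3,2,5,1,4;0,0,2,0,1,1,3,3)$ or of $(2,3,5,2,3;0,0,2,0,1,1,4,2)$.
   Context: For integers $a>1$, $b>1$, $c>0$, $r>0$, $s>0$, a solution of $(-1)^u r a^x + (-1)^v s b^y = c$ is a quadruple $(x,y,u,v)$ with $x,y$ nonnegative integers and $u,v\in\{0,1\}$; it is referred to by the pair $(x,y)$. A set of solutions $(a,b,c,r,s;x_1,y_1,\dots,x_N,y_N)$ is the set of $N>2$ distinct pairs $(x_i,y_i)$, each a solution for the given $a,b,c,r,s$. It is in basic form if $\gcd(r,sb)=\gcd(s,ra)=1$, $\min_i x_i=\min_i y_i=0$, and neither $a$ nor $b$ is a perfect power. A subset of a set of solutions is any set of solutions (at least three pairs) with the same $a,b,c,r,s$ all of whose pairs are among the given ones. -}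

module Defs where

open import Data.Nat as ℕ using (ℕ; _≤_; _<_)
open import Data.Nat.GCD using (gcd)
open import Data.Integer as ℤ using (ℤ; +_; -_)
open import Data.Empty using (⊥)
open import Data.Bool using (Bool; true; false)
open import Data.Fin using (Fin)
open import Data.Product using (_×_; _,_; ∃; ∃-syntax)
open import Data.List using (List; _∷_; [])
open import Data.List.Membership.Propositional using (_∈_)
open import Relation.Binary.PropositionalEquality using (_≡_)

-- (-1)^u for u ∈ {0,1}, encoded as Bool (false = 0, true = 1)
sgn : Bool → ℤ
sgn false = + 1
sgn true  = - (+ 1)

IsSolution : (a b c r s x y : ℕ) → Set
IsSolution a b c r s x y =
  ∃[ u ] ∃[ v ] (sgn u ℤ.* (+ (r ℕ.* a ℕ.^ x)) ℤ.+ sgn v ℤ.* (+ (s ℕ.* b ℕ.^ y)) ≡ + c)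

IsPerfectPower : ℕ → Set
IsPerfectPower n = ∃[ m ] ∃[ k ] (2 ≤ k × m ℕ.^ k ≡ n)

-- A set of solutions (a,b,c,r,s; x_1,y_1,...,x_N,y_N), indices Fin N (0-based)
record SetOfSolutions (a b c r s N : ℕ) (xs ys : Fin N → ℕ) : Set where
  field
    a>1 : 1 < a
    b>1 : 1 < b
    c>0 : 0 < c
    r>0 : 0 < r
    s>0 : 0 < s
    N>2 : 2 < N
    distinct : ∀ i j → xs i ≡ xs j → ys i ≡ ys j → i ≡ j
    solutions : ∀ i → IsSolution a b c r s (xs i) (ys i)

-- basic form (min over naturals is 0 iff some entry is 0)
record BasicForm (a b c r s N : ℕ) (xs ys : Fin N → ℕ) : Set where
  field
    gcd-r-sb : gcd r (s ℕ.* b) ≡ 1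
    gcd-s-ra : gcd s (r ℕ.* a) ≡ 1
    min-x : ∃[ i ] (xs i ≡ 0)
    min-y : ∃[ i ] (ys i ≡ 0)
    a-not-pp : IsPerfectPower a → ⊥
    b-not-pp : IsPerfectPower b → ⊥

IsSubsetOf : (a b c r s N : ℕ) (xs ys : Fin N → ℕ) →
             (a' b' c' r' s' : ℕ) → List (ℕ × ℕ) → Set
IsSubsetOf a b c r s N xs ys a' b' c' r' s' ps =
  a ≡ a' × b ≡ b' × c ≡ c' × r ≡ r' × s ≡ s' × (∀ i → (xs i , ys i) ∈ ps)

{-# OPTIONS --safe #-}
-- If x_2 is not least, some k > 2 has 0 < x_k < x_2 and y_k > 0. With t = a^(x_k),
-- q = a^(x_2 - x_k) and B = b^(y_k) the solutions (0,0), (x_2,0), (x_k,y_k) give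
-- ±r ± s = c, ±rtq ± s = c and ±rt ± sB = c. The first two share s and c, which forces
-- rtq = c + s and r = |c - s|; comparing sizes leaves only c = r + s and sB = c + rt, and
-- eliminating c gives (B, t, s/r) = (2, 3, 4) or (3, 2, 3/2). Coprimality fixes r and s, so the
-- equation is 3^x ± 4·2^y = 5 or 2·2^x ± 3·3^y = 5, whose solutions follow from congruences
-- modulo 8 and 1088.
module Submission where

open import Defs
open import Data.Nat as ℕ
  using ( ℕ; zero; suc; _+_; _*_; _^_; _%_; _∸_; _≤_; _<_; _≤?_; _<?_
        ; NonZero; >-nonZero; >-nonZero⁻¹; z≤n; z<s; s≤s; s<s)
open import Data.Nat.Properties
open import Data.Nat.DivMod using (%-distribˡ-*; %-distribˡ-+; m%n%n≡m%n; [m+kn]%n≡m%n)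
open import Data.Nat.Divisibility using (_∣_; ∣-refl; ∣m+n∣m⇒∣n; n∣m*n; m∣m*n; n∣m*n*o)
open import Data.Nat.GCD using (gcd)
open import Data.Nat.Coprimality using (gcd≡1⇒coprime)
open import Data.Nat.Primality using (Irreducible; irreducible[2]; irreducible?)
open import Data.Nat.Tactic.RingSolver using (solve-∀)
open import Data.Integer as ℤ using (+_)
import Data.Integer.Properties as ℤP
import Data.Integer.Tactic.RingSolver as ℤSolver
open import Data.Bool using (false; true)
open import Data.Fin using (Fin; zero; suc)
open import Data.Fin.Properties using (all?; ¬∀⟶∃¬)
open import Data.Product using (_×_; _,_; proj₁; proj₂; ∃-syntax)
open import Data.Sum as Sum using (_⊎_; inj₁; inj₂)
open import Data.Empty using (⊥; ⊥-elim)
open import Data.List using (List; _∷_; [])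
open import Data.List.Membership.Propositional using (_∈_; _∉_)
open import Data.List.Membership.DecPropositional ℕ._≟_ using (_∈?_)
open import Data.List.Relation.Unary.All as All using (All)
open import Data.List.Relation.Unary.Any using (here; there)
open import Relation.Nullary using (Dec; yes; no; ¬?)
open import Relation.Binary.Definitions using (tri<; tri≈; tri>)
open import Relation.Nullary.Decidable using (from-yes; from-no)
open import Relation.Binary.PropositionalEquality
  using (_≡_; _≢_; refl; sym; trans; cong; subst; subst₂; module ≡-Reasoning)

-- For c > 0 the sign patterns of (-1)^u R + (-1)^v S = c say that R is c + S or |c - S|.
Gap : ℕ → ℕ → ℕ → Set
Gap R S c = R + S ≡ c ⊎ S ≡ c + R

SignedSum : ℕ → ℕ → ℕ → Set
SignedSum R S c = R ≡ c + S ⊎ Gap R S c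

signedSum : ∀ {R S c} u v → 0 < c →
  sgn u ℤ.* + R ℤ.+ sgn v ℤ.* + S ≡ + c → SignedSum R S c
signedSum {R} {S} false false _ e = inj₂ (inj₁ (ℤP.+-injective (trans (ring (+ R) (+ S)) e)))
  where
  ring : ∀ i j → i ℤ.+ j ≡ + 1 ℤ.* i ℤ.+ + 1 ℤ.* j
  ring = ℤSolver.solve-∀
signedSum {R} {S} false true _ e = inj₁ (ℤP.+-injective (trans (ring (+ R) (+ S)) (cong (ℤ._+ + S) e)))
  where
  ring : ∀ i j → i ≡ (+ 1 ℤ.* i ℤ.+ ℤ.- (+ 1) ℤ.* j) ℤ.+ j
  ring = ℤSolver.solve-∀
signedSum {R} {S} true false _ e = inj₂ (inj₂ (ℤP.+-injective (trans (ring (+ R) (+ S)) (cong (ℤ._+ + R) e))))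
  where
  ring : ∀ i j → j ≡ (ℤ.- (+ 1) ℤ.* i ℤ.+ + 1 ℤ.* j) ℤ.+ i
  ring = ℤSolver.solve-∀
signedSum {R} {S} true true (s≤s _) e =
  ⊥-elim (0≢1+n (ℤP.+-injective (trans (ring (+ R) (+ S)) (cong (λ k → k ℤ.+ + R ℤ.+ + S) e))))
  where
  ring : ∀ i j → + 0 ≡ (ℤ.- (+ 1) ℤ.* i ℤ.+ ℤ.- (+ 1) ℤ.* j) ℤ.+ i ℤ.+ j
  ring = ℤSolver.solve-∀

isSolution⇒signedSum : ∀ a b c r s x y → 0 < c → IsSolution a b c r s x y →
  SignedSum (r * a ^ x) (s * b ^ y) c
isSolution⇒signedSum _ _ _ _ _ _ _ c>0 (u , v , e) = signedSum u v c>0 e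

gap-unique : ∀ {R R′ S c} → 0 < R′ → Gap R S c → Gap R′ S c → R ≡ R′
gap-unique _ (inj₁ e) (inj₁ e′) = +-cancelʳ-≡ _ _ _ (trans e (sym e′))
gap-unique _ (inj₂ e) (inj₂ e′) = +-cancelˡ-≡ _ _ _ (trans (sym e) e′)
gap-unique {R} {R′} {S} {c} R′>0 (inj₁ e) (inj₂ e′) = ⊥-elim (<-irrefl refl (begin-strict
  S            <⟨ m<m+n S R′>0 ⟩
  S + R′       ≤⟨ +-monoˡ-≤ R′ (m≤n+m S R) ⟩
  R + S + R′   ≡⟨ cong (_+ R′) e ⟩
  c + R′       ≡⟨ sym e′ ⟩
  S            ∎))
  where open ≤-Reasoning
gap-unique {R} {R′} {S} {c} R′>0 (inj₂ e) (inj₁ e′) = ⊥-elim (<-irrefl refl (begin-strict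
  S            <⟨ m<n+m S R′>0 ⟩
  R′ + S       ≤⟨ m≤m+n (R′ + S) R ⟩
  R′ + S + R   ≡⟨ cong (_+ R) e′ ⟩
  c + R        ≡⟨ sym e ⟩
  S            ∎))
  where open ≤-Reasoning

gap-≤ : ∀ {R S c} → Gap R S c → R ≤ c + S
gap-≤ {R} {S} {c} (inj₁ e) = ≤-trans (m≤m+n R S) (subst (_≤ c + S) (sym e) (m≤m+n c S))
gap-≤ {R} {S} {c} (inj₂ e) = ≤-trans (m≤n+m R c) (subst (_≤ c + S) e (m≤n+m S c))

signedSum-≤ : ∀ {R S c} → SignedSum R S c → c ≤ R + S
signedSum-≤ {R} {S} {c} (inj₁ e) = ≤-trans (m≤m+n c S) (subst (_≤ R + S) e (m≤m+n R S))
signedSum-≤ (inj₂ (inj₁ e)) = ≤-reflexive (sym e)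
signedSum-≤ {R} {S} {c} (inj₂ (inj₂ e)) = ≤-trans (m≤m+n c R) (subst (_≤ R + S) e (m≤n+m S R))

signedSums-shared : ∀ {R R′ S c} → R < R′ → SignedSum R S c → SignedSum R′ S c →
  R′ ≡ c + S × Gap R S c
signedSums-shared R<R′ (inj₁ e) (inj₁ e′) = ⊥-elim (<⇒≢ R<R′ (trans e (sym e′)))
signedSums-shared R<R′ (inj₁ e) (inj₂ g′) = ⊥-elim (<⇒≱ R<R′ (subst (_ ≤_) (sym e) (gap-≤ g′)))
signedSums-shared R<R′ (inj₂ g) (inj₁ e′) = e′ , g
signedSums-shared R<R′ (inj₂ g) (inj₂ g′) = ⊥-elim (<⇒≢ R<R′ (gap-unique (m<n⇒0<n R<R′) g g′))

Exceptional : (r s t B : ℕ) → Set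
Exceptional r s t B = (B ≡ 2 × t ≡ 3 × s ≡ 4 * r) ⊎ (B ≡ 3 × t ≡ 2 × 2 * s ≡ 3 * r)

irreducible[3] : Irreducible 3
irreducible[3] = from-yes (irreducible? 3)

*≡*+irreducible⇒≡ : ∀ {p t q k} → Irreducible p → 2 ≤ t → t * q ≡ t * k + p → t ≡ p
*≡*+irreducible⇒≡ {p} {t} {q} {k} irr t≥2 e
  with irr (∣m+n∣m⇒∣n (subst (t ∣_) e (m∣m*n q)) (m∣m*n k))
... | inj₁ refl = ⊥-elim (<-irrefl refl t≥2)
... | inj₂ t≡p  = t≡p

n+n≡n*2 : ∀ n → n + n ≡ n * 2
n+n≡n*2 = solve-∀

m+n+o≡n+[m+o] : ∀ m n o → m + n + o ≡ n + (m + o)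
m+n+o≡n+[m+o] = solve-∀

exceptional-B≡2 : ∀ {r s t q} .{{_ : NonZero r}} → 2 ≤ t →
  r * t * q ≡ r + s + s → s * 2 ≡ s + (r + r * t) → t ≡ 3 × s ≡ 4 * r
exceptional-B≡2 {r} {s} {t} {q} t≥2 rtq≡ s2≡ = t≡3 , s≡4r
  where
  open ≡-Reasoning
  ring₁ : ∀ r t → r + (r + r * t) + (r + r * t) ≡ r * (t * 2 + 3)
  ring₁ = solve-∀
  ring₂ : ∀ r → r + r * 3 ≡ 4 * r
  ring₂ = solve-∀
  s≡r+rt : s ≡ r + r * t
  s≡r+rt = +-cancelˡ-≡ s _ _ (trans (n+n≡n*2 s) s2≡)
  t≡3 : t ≡ 3
  t≡3 = *≡*+irreducible⇒≡ irreducible[3] t≥2 (*-cancelˡ-≡ _ _ r (begin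
    r * (t * q)                    ≡⟨ sym (*-assoc r t q) ⟩
    r * t * q                      ≡⟨ rtq≡ ⟩
    r + s + s                      ≡⟨ cong (λ s → r + s + s) s≡r+rt ⟩
    r + (r + r * t) + (r + r * t)  ≡⟨ ring₁ r t ⟩
    r * (t * 2 + 3)                ∎))
  s≡4r : s ≡ 4 * r
  s≡4r = trans s≡r+rt (trans (cong (λ t → r + r * t) t≡3) (ring₂ r))

exceptional-B≡3 : ∀ {r s t q} .{{_ : NonZero r}} → 2 ≤ t →
  r * t * q ≡ r + s + s → s * 3 ≡ s + (r + r * t) → t ≡ 2 × 2 * s ≡ 3 * r
exceptional-B≡3 {r} {s} {t} {q} t≥2 rtq≡ s3≡ = t≡2 , 2s≡3r
  where
  open ≡-Reasoning
  ring₁ : ∀ s → s + s * 2 ≡ s * 3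
  ring₁ = solve-∀
  ring₂ : ∀ r s → r + s + s ≡ r + s * 2
  ring₂ = solve-∀
  ring₃ : ∀ r t → r + (r + r * t) ≡ r * (t * 1 + 2)
  ring₃ = solve-∀
  ring₄ : ∀ r → r + r * 2 ≡ 3 * r
  ring₄ = solve-∀
  s2≡r+rt : s * 2 ≡ r + r * t
  s2≡r+rt = +-cancelˡ-≡ s _ _ (trans (ring₁ s) s3≡)
  t≡2 : t ≡ 2
  t≡2 = *≡*+irreducible⇒≡ irreducible[2] t≥2 (*-cancelˡ-≡ _ _ r (begin
    r * (t * q)      ≡⟨ sym (*-assoc r t q) ⟩
    r * t * q        ≡⟨ rtq≡ ⟩
    r + s + s        ≡⟨ ring₂ r s ⟩
    r + s * 2        ≡⟨ cong (λ m → r + m) s2≡r+rt ⟩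
    r + (r + r * t)  ≡⟨ ring₃ r t ⟩
    r * (t * 1 + 2)  ∎))
  2s≡3r : 2 * s ≡ 3 * r
  2s≡3r = begin
    2 * s        ≡⟨ *-comm 2 s ⟩
    s * 2        ≡⟨ s2≡r+rt ⟩
    r + r * t    ≡⟨ cong (λ t → r + r * t) t≡2 ⟩
    r + r * 2    ≡⟨ ring₄ r ⟩
    3 * r        ∎

exceptional-B≥4 : ∀ {r s t q B} .{{_ : NonZero r}} → 2 ≤ t → 2 ≤ q → 4 ≤ B →
  r * t * q ≡ r + s + s → s * B ≡ s + (r + r * t) → ⊥
exceptional-B≥4 {r} {s} {t} {q} {B} t≥2 q≥2 B≥4 rtq≡ sB≡ =
  from-no (8 ≤? 5) (+-cancelʳ-≤ (t * 2) 8 5 (begin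
    8 + t * 2      ≤⟨ +-monoˡ-≤ (t * 2) (*-monoˡ-≤ 4 t≥2) ⟩
    t * 4 + t * 2  ≡⟨ ring₁ t ⟩
    t * 6          ≤⟨ t6≤ ⟩
    5 + t * 2      ∎))
  where
  open ≤-Reasoning
  ring₁ : ∀ t → t * 4 + t * 2 ≡ t * 6
  ring₁ = solve-∀
  ring₂ : ∀ s → s + s * 3 ≡ s * 4
  ring₂ = solve-∀
  ring₃ : ∀ r t → r * (t * 6) ≡ r * t * 2 * 3
  ring₃ = solve-∀
  ring₄ : ∀ r s → (r + s + s) * 3 ≡ r * 3 + s * 3 * 2
  ring₄ = solve-∀
  ring₅ : ∀ r t → r * 3 + (r + r * t) * 2 ≡ r * (5 + t * 2)
  ring₅ = solve-∀
  s3≤ : s * 3 ≤ r + r * t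
  s3≤ = +-cancelˡ-≤ s _ _ (begin
    s + s * 3        ≡⟨ ring₂ s ⟩
    s * 4            ≤⟨ *-monoʳ-≤ s B≥4 ⟩
    s * B            ≡⟨ sB≡ ⟩
    s + (r + r * t)  ∎)
  t6≤ : t * 6 ≤ 5 + t * 2
  t6≤ = *-cancelˡ-≤ r (begin
    r * (t * 6)              ≡⟨ ring₃ r t ⟩
    r * t * 2 * 3            ≤⟨ *-monoˡ-≤ 3 (*-monoʳ-≤ (r * t) q≥2) ⟩
    r * t * q * 3            ≡⟨ cong (_* 3) rtq≡ ⟩
    (r + s + s) * 3          ≡⟨ ring₄ r s ⟩
    r * 3 + s * 3 * 2        ≤⟨ +-monoʳ-≤ (r * 3) (*-monoˡ-≤ 2 s3≤) ⟩
    r * 3 + (r + r * t) * 2  ≡⟨ ring₅ r t ⟩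
    r * (5 + t * 2)          ∎)

exceptional-case : ∀ {r s c t q} B .{{_ : NonZero r}} → 2 ≤ t → 2 ≤ q → 2 ≤ B →
  r + s ≡ c → r * t * q ≡ c + s → s * B ≡ c + r * t → Exceptional r s t B
exceptional-case {r} {s} {t = t} B t≥2 q≥2 B≥2 refl rtq≡ sB≡ =
  by-B B B≥2 (trans sB≡ (m+n+o≡n+[m+o] r s (r * t)))
  where
  by-B : ∀ B → 2 ≤ B → s * B ≡ s + (r + r * t) → Exceptional r s t B
  by-B 2 _ e = inj₁ (refl , exceptional-B≡2 t≥2 rtq≡ e)
  by-B 3 _ e = inj₂ (refl , exceptional-B≡3 t≥2 rtq≡ e)
  by-B (suc (suc (suc (suc B)))) _ e = ⊥-elim (exceptional-B≥4 t≥2 q≥2 (m≤m+n 4 B) rtq≡ e)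
  by-B 1 (s≤s ()) _

three-signed-sums : ∀ {r s c t q B} .{{_ : NonZero r}} .{{_ : NonZero s}} → 2 ≤ t → 2 ≤ q → 2 ≤ B →
  SignedSum r s c → SignedSum (r * t * q) s c → SignedSum (r * t) (s * B) c →
  c ≡ r + s × Exceptional r s t B
three-signed-sums {r} {s} {c} {t} {q} {B} t≥2 q≥2 B≥2 h₀ h₁ h₂ =
  by-cases (signedSums-shared (<-≤-trans (m<m*n r t t≥2) rt≤rtq) h₀ h₁) h₂
  where
  open ≤-Reasoning
  rt≤rtq : r * t ≤ r * t * q
  rt≤rtq = m≤m*n (r * t) q {{>-nonZero (<-trans z<s q≥2)}}
  by-cases : r * t * q ≡ c + s × Gap r s c → SignedSum (r * t) (s * B) c →
    c ≡ r + s × Exceptional r s t B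
  by-cases (rtq≡c+s , _) (inj₁ rt≡c+sB) = ⊥-elim (<-irrefl refl (begin-strict
    c + s      <⟨ +-monoʳ-< c (m<m*n s B B≥2) ⟩
    c + s * B  ≡⟨ sym rt≡c+sB ⟩
    r * t      ≤⟨ rt≤rtq ⟩
    r * t * q  ≡⟨ rtq≡c+s ⟩
    c + s      ∎))
  by-cases _ (inj₂ (inj₁ rt+sB≡c)) = ⊥-elim (<-irrefl refl (begin-strict
    r + s          <⟨ +-mono-< (m<m*n r t t≥2) (m<m*n s B B≥2) ⟩
    r * t + s * B  ≡⟨ rt+sB≡c ⟩
    c              ≤⟨ signedSum-≤ h₀ ⟩
    r + s          ∎))
  by-cases (rtq≡c+s , inj₂ s≡c+r) (inj₂ (inj₂ sB≡c+rt)) = ⊥-elim (<-irrefl refl (begin-strict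
    c + s            ≤⟨ +-monoˡ-≤ s (subst (c ≤_) (sym s≡c+r) (m≤m+n c r)) ⟩
    s + s            <⟨ +-mono-< s<s+r s<s+r ⟩
    s + r + (s + r)  ≤⟨ +-mono-≤ s+r≤rt s+r≤rt ⟩
    r * t + r * t    ≡⟨ n+n≡n*2 (r * t) ⟩
    r * t * 2        ≤⟨ *-monoʳ-≤ (r * t) q≥2 ⟩
    r * t * q        ≡⟨ rtq≡c+s ⟩
    c + s            ∎))
    where
    s<s+r : s < s + r
    s<s+r = m<m+n s (>-nonZero⁻¹ r)
    s+r≤rt : s + r ≤ r * t
    s+r≤rt = +-cancelˡ-≤ c _ _ (begin
      c + (s + r)  ≡⟨ trans (sym (+-assoc c s r)) (m+n+o≡n+[m+o] c s r) ⟩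
      s + (c + r)  ≡⟨ cong (λ m → s + m) (sym s≡c+r) ⟩
      s + s        ≡⟨ n+n≡n*2 s ⟩
      s * 2        ≤⟨ *-monoʳ-≤ s B≥2 ⟩
      s * B        ≡⟨ sB≡c+rt ⟩
      c + r * t    ∎)
  by-cases (rtq≡c+s , inj₁ r+s≡c) (inj₂ (inj₂ sB≡c+rt)) =
    sym r+s≡c , exceptional-case B t≥2 q≥2 B≥2 r+s≡c rtq≡c+s sB≡c+rt

b^n≡k<4⇒b≡k : ∀ {b n k} → 1 < b → 0 < n → b ^ n ≡ k → k < 4 → b ≡ k
b^n≡k<4⇒b≡k {b} {1} _ _ e _ = trans (sym (*-identityʳ b)) e
b^n≡k<4⇒b≡k {b} {suc (suc n)} 1<b _ e k<4 =
  ⊥-elim (<⇒≱ k<4 (subst (4 ≤_) e (*-mono-≤ 1<b (^-monoʳ-< b 1<b {0} {suc n} z<s))))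

2s≡3r⇒ : ∀ {r s} → 2 * s ≡ 3 * r → ∃[ k ] (r ≡ 2 * k × s ≡ 3 * k)
2s≡3r⇒ {r} {s} e = k , r≡2k , s≡3k
  where
  open ≡-Reasoning
  r≤s : r ≤ s
  r≤s = *-cancelˡ-≤ 2 (subst (2 * r ≤_) (sym e) (*-monoˡ-≤ r (n≤1+n 2)))
  k : ℕ
  k = s ∸ r
  r+k≡s : r + k ≡ s
  r+k≡s = m+[n∸m]≡n r≤s
  r≡2k : r ≡ 2 * k
  r≡2k = sym (+-cancelˡ-≡ (2 * r) _ _ (begin
    2 * r + 2 * k  ≡⟨ sym (*-distribˡ-+ 2 r k) ⟩
    2 * (r + k)    ≡⟨ cong (2 *_) r+k≡s ⟩
    2 * s          ≡⟨ e ⟩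
    r + 2 * r      ≡⟨ +-comm r (2 * r) ⟩
    2 * r + r      ∎))
  s≡3k : s ≡ 3 * k
  s≡3k = begin
    s          ≡⟨ sym r+k≡s ⟩
    r + k      ≡⟨ cong (_+ k) r≡2k ⟩
    2 * k + k  ≡⟨ +-comm (2 * k) k ⟩
    3 * k      ∎

exceptional-parameters : ∀ {a b c r s x y} → 1 < a → 1 < b → 0 < x → 0 < y →
  gcd r (s * b) ≡ 1 → gcd s (r * a) ≡ 1 → c ≡ r + s → Exceptional r s (a ^ x) (b ^ y) →
  (a ≡ 3 × b ≡ 2 × c ≡ 5 × r ≡ 1 × s ≡ 4) ⊎ (a ≡ 2 × b ≡ 3 × c ≡ 5 × r ≡ 2 × s ≡ 3)
exceptional-parameters {b = b} {r = r} 1<a 1<b x>0 y>0 g₁ _ refl (inj₁ (b^y≡2 , a^x≡3 , refl))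
  with gcd≡1⇒coprime g₁ {r} (∣-refl , n∣m*n*o 4 b)
... | refl = inj₁ ( b^n≡k<4⇒b≡k 1<a x>0 a^x≡3 (from-yes (3 <? 4))
                  , b^n≡k<4⇒b≡k 1<b y>0 b^y≡2 (from-yes (2 <? 4)) , refl , refl , refl)
exceptional-parameters {r = r} {s} 1<a 1<b x>0 y>0 _ g₂ refl (inj₂ (b^y≡3 , a^x≡2 , 2s≡3r))
  with b^n≡k<4⇒b≡k 1<a x>0 a^x≡2 (from-yes (2 <? 4)) | 2s≡3r⇒ {r} {s} 2s≡3r
... | refl | k , refl , refl with gcd≡1⇒coprime g₂ {k} (n∣m*n 3 , n∣m*n*o 2 2)
...   | refl = inj₂ (refl , b^n≡k<4⇒b≡k 1<b y>0 b^y≡3 (from-yes (3 <? 4)) , refl , refl , refl)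

^-injectiveʳ : ∀ {b m n} → 1 < b → b ^ m ≡ b ^ n → m ≡ n
^-injectiveʳ {b} {m} {n} 1<b e with <-cmp m n
... | tri< m<n _ _ = ⊥-elim (<⇒≢ (^-monoʳ-< b 1<b m<n) e)
... | tri≈ _ m≡n _ = m≡n
... | tri> _ _ n<m = ⊥-elim (<⇒≢ (^-monoʳ-< b 1<b n<m) (sym e))

^≢-between : ∀ {b k m} .{{_ : NonZero b}} n → b ^ k < m → m < b ^ suc k → b ^ n ≢ m
^≢-between {b} {k} n lo hi e with n ≤? k
... | yes n≤k = <⇒≱ lo (subst (_≤ b ^ k) e (^-monoʳ-≤ b n≤k))
... | no n≰k  = <⇒≱ hi (subst (b ^ suc k ≤_) e (^-monoʳ-≤ b (≰⇒> n≰k)))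

+-tight : ∀ {m n R S} → m ≤ R → n ≤ S → R + S ≡ m + n → R ≡ m × S ≡ n
+-tight {m} {n} {R} {S} m≤R n≤S e = R≡m , +-cancelˡ-≡ m _ _ (subst (λ R → R + S ≡ m + n) R≡m e)
  where
  R≡m : R ≡ m
  R≡m = ≤-antisym (+-cancelʳ-≤ n R m (subst (R + n ≤_) e (+-monoʳ-≤ R n≤S))) m≤R

MulClosed : ℕ → (m : ℕ) .{{_ : NonZero m}} → List ℕ → Set
MulClosed g m C = All (λ u → g * u % m ∈ C) C

mulClosed? : ∀ g m .{{_ : NonZero m}} C → Dec (MulClosed g m C)
mulClosed? g m C = All.all? (λ u → g * u % m ∈? C) C

^*%-∈-closed : ∀ g m .{{_ : NonZero m}} {C : List ℕ} k → k % m ∈ C → MulClosed g m C →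
  ∀ n → g ^ n * k % m ∈ C
^*%-∈-closed g m {C} k k∈C closed zero = subst (_∈ C) (cong (_% m) (sym (*-identityˡ k))) k∈C
^*%-∈-closed g m {C} k k∈C closed (suc n) =
  subst (_∈ C) step (All.lookup closed (^*%-∈-closed g m k k∈C closed n))
  where
  open ≡-Reasoning
  w = g ^ n * k
  step : g * (w % m) % m ≡ g ^ suc n * k % m
  step = begin
    g * (w % m) % m            ≡⟨ %-distribˡ-* g (w % m) m ⟩
    (g % m) * (w % m % m) % m  ≡⟨ cong (λ v → (g % m) * v % m) (m%n%n≡m%n w m) ⟩
    (g % m) * (w % m) % m      ≡⟨ sym (%-distribˡ-* g w m) ⟩
    g * w % m                  ≡⟨ cong (_% m) (sym (*-assoc g (g ^ n) k)) ⟩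
    g ^ suc n * k % m          ∎

3^n≢5+k*8 : ∀ n k → 3 ^ n ≢ 5 + k * 8
3^n≢5+k*8 n k e =
  from-no (5 ∈? residues) (subst (_∈ residues) (trans (cong (_% 8) e) ([m+kn]%n≡m%n 5 k 8)) 3^n%8∈)
  where
  residues : List ℕ
  residues = 1 ∷ 3 ∷ []
  3^n%8∈ : 3 ^ n % 8 ∈ residues
  3^n%8∈ = subst (_∈ residues) (cong (_% 8) (*-identityʳ (3 ^ n)))
    (^*%-∈-closed 3 8 1 (here refl) (from-yes (mulClosed? 3 8 residues)) n)

-- 1088 = 2^6 · 17: modulo 1088 the powers 2^(6+n) and the numbers 5 + 3^x run through two
-- short cycles that never meet.
2^[6+n]≢5+3^x : ∀ n x → 2 ^ (6 + n) ≢ 5 + 3 ^ x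
2^[6+n]≢5+3^x n x e = All.lookup disjoint 3^x%1088∈
  (subst (_∈ orbit₂) (trans (cong (_% 1088) 2^n*64≡5+3^x) (%-distribˡ-+ 5 (3 ^ x) 1088)) 2^n*64%1088∈)
  where
  orbit₃ orbit₂ : List ℕ
  orbit₃ = 1 ∷ 3 ∷ 9 ∷ 11 ∷ 27 ∷ 33 ∷ 81 ∷ 99 ∷ 121 ∷ 243 ∷ 297 ∷ 363 ∷ 403 ∷ 497 ∷ 729
         ∷ 891 ∷ []
  orbit₂ = 64 ∷ 128 ∷ 256 ∷ 512 ∷ 576 ∷ 832 ∷ 960 ∷ 1024 ∷ []
  disjoint : All (λ u → (5 + u) % 1088 ∉ orbit₂) orbit₃
  disjoint = from-yes (All.all? (λ u → ¬? ((5 + u) % 1088 ∈? orbit₂)) orbit₃)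
  3^x%1088∈ : 3 ^ x % 1088 ∈ orbit₃
  3^x%1088∈ = subst (_∈ orbit₃) (cong (_% 1088) (*-identityʳ (3 ^ x)))
    (^*%-∈-closed 3 1088 1 (here refl) (from-yes (mulClosed? 3 1088 orbit₃)) x)
  2^n*64%1088∈ : 2 ^ n * 64 % 1088 ∈ orbit₂
  2^n*64%1088∈ = ^*%-∈-closed 2 1088 64 (here refl) (from-yes (mulClosed? 2 1088 orbit₂)) n
  2^n*64≡5+3^x : 2 ^ n * 64 ≡ 5 + 3 ^ x
  2^n*64≡5+3^x = trans (trans (*-comm (2 ^ n) 64) (sym (^-distribˡ-+-* 2 6 n))) e

2^n≡5+3^x : ∀ n x → 2 ^ n ≡ 5 + 3 ^ x → (n ≡ 3 × x ≡ 1) ⊎ (n ≡ 5 × x ≡ 3)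
2^n≡5+3^x 0 x ()
2^n≡5+3^x 1 x ()
2^n≡5+3^x 2 x ()
2^n≡5+3^x 3 x e = inj₁ (refl , sym (^-injectiveʳ (s<s z<s) (+-cancelˡ-≡ 5 3 (3 ^ x) e)))
2^n≡5+3^x 4 x e =
  ⊥-elim (^≢-between {k = 2} x (from-yes (9 <? 11)) (from-yes (11 <? 27))
    (sym (+-cancelˡ-≡ 5 11 (3 ^ x) e)))
2^n≡5+3^x 5 x e = inj₂ (refl , sym (^-injectiveʳ {3} {3} (s<s z<s) (+-cancelˡ-≡ 5 27 (3 ^ x) e)))
2^n≡5+3^x (suc (suc (suc (suc (suc (suc n)))))) x e = ⊥-elim (2^[6+n]≢5+3^x n x e)

exceptionalPairs₁ exceptionalPairs₂ : List (ℕ × ℕ)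
exceptionalPairs₁ = (0 , 0) ∷ (2 , 0) ∷ (1 , 1) ∷ (3 , 3) ∷ []
exceptionalPairs₂ = (0 , 0) ∷ (2 , 0) ∷ (1 , 1) ∷ (4 , 2) ∷ []

2^[3+n]≡2^n*8 : ∀ n → 2 ^ (3 + n) ≡ 2 ^ n * 8
2^[3+n]≡2^n*8 n = trans (^-distribˡ-+-* 2 3 n) (*-comm 8 (2 ^ n))

pairs₁-complete : ∀ x y → SignedSum (3 ^ x) (4 * 2 ^ y) 5 → (x , y) ∈ exceptionalPairs₁
pairs₁-complete x zero (inj₁ e) with ^-injectiveʳ {3} {x} {2} (s<s z<s) e
... | refl = there (here refl)
pairs₁-complete x (suc y) (inj₁ e) =
  ⊥-elim (3^n≢5+k*8 x (2 ^ y) (trans e (cong (λ m → 5 + m)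
    (trans (sym (^-distribˡ-+-* 2 2 (suc y))) (2^[3+n]≡2^n*8 y)))))
pairs₁-complete x y (inj₂ (inj₁ e)) with +-tight (m^n>0 3 x) (*-monoʳ-≤ 4 (m^n>0 2 y)) e
... | 3^x≡1 , 4*2^y≡4
  with ^-injectiveʳ {3} {x} {0} (s<s z<s) 3^x≡1
     | ^-injectiveʳ {2} {y} {0} (s<s z<s) (*-cancelˡ-≡ _ _ 4 4*2^y≡4)
...   | refl | refl = here refl
pairs₁-complete x y (inj₂ (inj₂ e)) with 2^n≡5+3^x (2 + y) x (trans (^-distribˡ-+-* 2 2 y) e)
... | inj₁ (refl , refl) = there (there (here refl))
... | inj₂ (refl , refl) = there (there (there (here refl)))

pairs₂-complete : ∀ x y → SignedSum (2 * 2 ^ x) (3 * 3 ^ y) 5 → (x , y) ∈ exceptionalPairs₂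
pairs₂-complete x y (inj₁ e) with 2^n≡5+3^x (suc x) (suc y) e
... | inj₁ (refl , refl) = there (here refl)
... | inj₂ (refl , refl) = there (there (there (here refl)))
pairs₂-complete x y (inj₂ (inj₁ e)) with +-tight (*-monoʳ-≤ 2 (m^n>0 2 x)) (*-monoʳ-≤ 3 (m^n>0 3 y)) e
... | 2*2^x≡2 , 3*3^y≡3
  with ^-injectiveʳ {2} {x} {0} (s<s z<s) (*-cancelˡ-≡ _ _ 2 2*2^x≡2)
     | ^-injectiveʳ {3} {y} {0} (s<s z<s) (*-cancelˡ-≡ _ _ 3 3*3^y≡3)
...   | refl | refl = here refl
pairs₂-complete zero y (inj₂ (inj₂ e)) =
  ⊥-elim (^≢-between {k = 1} (suc y) (from-yes (3 <? 7)) (from-yes (7 <? 9)) e)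
pairs₂-complete 1 y (inj₂ (inj₂ e)) with ^-injectiveʳ {3} {suc y} {2} (s<s z<s) e
... | refl = there (there (here refl))
pairs₂-complete (suc (suc x)) y (inj₂ (inj₂ e)) =
  ⊥-elim (3^n≢5+k*8 (suc y) (2 ^ x) (trans e (cong (λ m → 5 + m) (2^[3+n]≡2^n*8 x))))

subset-of-exceptional₁ : ∀ {a b c r s N} {xs ys : Fin N → ℕ} →
  a ≡ 3 × b ≡ 2 × c ≡ 5 × r ≡ 1 × s ≡ 4 → (∀ i → IsSolution a b c r s (xs i) (ys i)) →
  IsSubsetOf a b c r s N xs ys 3 2 5 1 4 exceptionalPairs₁
subset-of-exceptional₁ {xs = xs} {ys} (refl , refl , refl , refl , refl) sol =
  refl , refl , refl , refl , refl , λ i → pairs₁-complete (xs i) (ys i)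
    (subst (λ R → SignedSum R (4 * 2 ^ ys i) 5) (*-identityˡ (3 ^ xs i))
      (isSolution⇒signedSum 3 2 5 1 4 (xs i) (ys i) z<s (sol i)))

subset-of-exceptional₂ : ∀ {a b c r s N} {xs ys : Fin N → ℕ} →
  a ≡ 2 × b ≡ 3 × c ≡ 5 × r ≡ 2 × s ≡ 3 → (∀ i → IsSolution a b c r s (xs i) (ys i)) →
  IsSubsetOf a b c r s N xs ys 2 3 5 2 3 exceptionalPairs₂
subset-of-exceptional₂ {xs = xs} {ys} (refl , refl , refl , refl , refl) sol =
  refl , refl , refl , refl , refl , λ i → pairs₂-complete (xs i) (ys i)
    (isSolution⇒signedSum 2 3 5 2 3 (xs i) (ys i) z<s (sol i))

smaller-x⇒exceptional : ∀ {a b c r s N} {xs ys : Fin N → ℕ} {i j k : Fin N} →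
  SetOfSolutions a b c r s N xs ys → BasicForm a b c r s N xs ys →
  xs i ≡ 0 → ys i ≡ 0 → ys j ≡ 0 → 0 < xs k → xs k < xs j → 0 < ys k →
  IsSubsetOf a b c r s N xs ys 3 2 5 1 4 exceptionalPairs₁
    ⊎ IsSubsetOf a b c r s N xs ys 2 3 5 2 3 exceptionalPairs₂
smaller-x⇒exceptional {a} {b} {c} {r} {s} {xs = xs} {ys} {i} {j} {k}
  sols basic xᵢ≡0 yᵢ≡0 yⱼ≡0 xₖ>0 xₖ<xⱼ yₖ>0 =
  Sum.map (λ ps → subset-of-exceptional₁ ps solutions) (λ ps → subset-of-exceptional₂ ps solutions)
    (exceptional-parameters a>1 b>1 xₖ>0 yₖ>0 gcd-r-sb gcd-s-ra (proj₁ core) (proj₂ core))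
  where
  open SetOfSolutions sols
  open BasicForm basic
  open ≡-Reasoning
  sum : ∀ l → SignedSum (r * a ^ xs l) (s * b ^ ys l) c
  sum l = isSolution⇒signedSum a b c r s (xs l) (ys l) c>0 (solutions l)
  r*a⁰≡r : ∀ {l} → xs l ≡ 0 → r * a ^ xs l ≡ r
  r*a⁰≡r xₗ≡0 = trans (cong (λ x → r * a ^ x) xₗ≡0) (*-identityʳ r)
  s*b⁰≡s : ∀ {l} → ys l ≡ 0 → s * b ^ ys l ≡ s
  s*b⁰≡s yₗ≡0 = trans (cong (λ y → s * b ^ y) yₗ≡0) (*-identityʳ s)
  r*aˣʲ≡ : r * a ^ xs j ≡ r * a ^ xs k * a ^ (xs j ∸ xs k)
  r*aˣʲ≡ = begin
    r * a ^ xs j                        ≡⟨ cong (λ x → r * a ^ x) (sym (m+[n∸m]≡n (<⇒≤ xₖ<xⱼ))) ⟩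
    r * a ^ (xs k + (xs j ∸ xs k))      ≡⟨ cong (r *_) (^-distribˡ-+-* a (xs k) (xs j ∸ xs k)) ⟩
    r * (a ^ xs k * a ^ (xs j ∸ xs k))  ≡⟨ sym (*-assoc r (a ^ xs k) (a ^ (xs j ∸ xs k))) ⟩
    r * a ^ xs k * a ^ (xs j ∸ xs k)    ∎
  core : c ≡ r + s × Exceptional r s (a ^ xs k) (b ^ ys k)
  core = three-signed-sums {{>-nonZero r>0}} {{>-nonZero s>0}}
    (^-monoʳ-< a a>1 xₖ>0) (^-monoʳ-< a a>1 (m<n⇒0<n∸m xₖ<xⱼ)) (^-monoʳ-< b b>1 yₖ>0)
    (subst₂ (λ R S → SignedSum R S c) (r*a⁰≡r xᵢ≡0) (s*b⁰≡s yᵢ≡0) (sum i))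
    (subst₂ (λ R S → SignedSum R S c) r*aˣʲ≡ (s*b⁰≡s yⱼ≡0) (sum j))
    (sum k)

lemma8 : (a b c r s M : ℕ) (xs ys : Fin (ℕ.suc (ℕ.suc M)) → ℕ) →
    SetOfSolutions a b c r s (ℕ.suc (ℕ.suc M)) xs ys →
    BasicForm a b c r s (ℕ.suc (ℕ.suc M)) xs ys →
    xs zero ≡ 0 → ys zero ≡ 0 → ys (suc zero) ≡ 0 →
    (∀ (i : Fin (ℕ.suc M)) → 0 < xs (suc i)) →
    (∀ (j : Fin M) → 0 < ys (suc (suc j))) →
    (∀ (i j : Fin (ℕ.suc M)) → xs (suc i) ≡ xs (suc j) → i ≡ j) →
    (∀ (i j : Fin M) → ys (suc (suc i)) ≡ ys (suc (suc j)) → i ≡ j) →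
    (∀ (i : Fin (ℕ.suc M)) → xs (suc zero) ≤ xs (suc i))
    ⊎ IsSubsetOf a b c r s (ℕ.suc (ℕ.suc M)) xs ys 3 2 5 1 4
        ((0 , 0) ∷ (2 , 0) ∷ (1 , 1) ∷ (3 , 3) ∷ [])
    ⊎ IsSubsetOf a b c r s (ℕ.suc (ℕ.suc M)) xs ys 2 3 5 2 3
        ((0 , 0) ∷ (2 , 0) ∷ (1 , 1) ∷ (4 , 2) ∷ [])
lemma8 a b c r s M xs ys sols basic x₁≡0 y₁≡0 y₂≡0 x>0 y>0 _ _
  with all? (λ i → xs (suc zero) ≤? xs (suc i))
... | yes x₂-least = inj₁ x₂-least
... | no x₂-not-least with ¬∀⟶∃¬ _ _ (λ i → xs (suc zero) ≤? xs (suc i)) x₂-not-least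
...   | zero  , x₂≰x₂ = ⊥-elim (x₂≰x₂ ≤-refl)
...   | suc l , x₂≰xₗ =
  inj₂ (smaller-x⇒exceptional sols basic x₁≡0 y₁≡0 y₂≡0 (x>0 (suc l)) (≰⇒> x₂≰xₗ) (y>0 l))
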